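{- Let $p$ be a positive integer, $H$ a graph, $T$ a complete rooted ternary tree and $V\subseteq V(T(H))$. Let $T_1,\dots,T_q$ be a minimal sequence of largest subtrees of $T$ with respect to $V$ lacking $p$, with corresponding sets $V_1,\dots,V_q$. Suppose $OC(T,V)\subsetneq V(T)$. Let $T^*$ be the tree obtained from $T$ by deleting the vertices of $T_q$, and let $V^*=V\cap V(T^*(H))$. Then $OC(T^*,V^*)\subsetneq V(T^*)$.
   Context: $T(H)$: disjoint copies $H^w$ ($w\in V(T)$) of $H$ with $w^i$ the copy of vertex $i$, plus edges $\{w^i,z^i\}$ for each vertex $i$ of $H$ and each edge $\{w,z\}$ of $T$; for a subtree $T'$ of $T$, $T'(H)$ is the subgraph formed by the copies over $V(T')$. For a subtree $T'$ and $V'\subseteq V(T(H))$, $OC(T',V')$ is the set of $w\in V(T')$ with $V(H^w)\cap V'\ne\emptyset$. A complete rooted ternary tree is a rooted tree in which every non-leaf vertex has 3 children and all root-leaf paths have the same length. An immediate subtree of $T$ is the subtree consisting of a child of the root and all its descendants; it is a largest immediate subtree w.r.t. $V$ if $|OC(T,V)\cap V(T')|$ is maximum among the immediate subtrees $T'$. A sequence of largest subtrees of $T$ w.r.t. $V$ is $T_1,\dots,T_q$ with $T_1=T$, $T_{i+1}$ a largest immediate subtree of $T_i$ w.r.t. $V_i$, with corresponding sets $V_1=V$, $V_{i+1}=V_i\cap V(T_{i+1}(H))$. It is a minimal sequence of largest subtrees lacking $p$ if $|OC(T_1,V_1)|-|OC(T_q,V_q)|\ge p$ while $|OC(T_1,V_1)|-|OC(T_{q-1},V_{q-1})|<p$.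 -}

module Defs where

open import Data.Nat using (ℕ; zero; suc; _≤_; _<_; _+_)
open import Data.Fin using (Fin; _≟_)
open import Data.Bool using (Bool; true; false; _∧_; not)
open import Data.List using (List; []; _∷_; length; map; concatMap; allFin; filterᵇ; _∷ʳ_)
open import Data.Bool.ListAction using (any)
open import Data.Product using (_×_; Σ; ∃)
open import Relation.Nullary using (¬_)
open import Relation.Nullary.Decidable using (⌊_⌋)
open import Relation.Binary.PropositionalEquality using (_≡_)

record Graph : Set₁ where
  field
    n      : ℕ
    Adj    : Fin n → Fin n → Set
    symm   : ∀ {i j} → Adj i j → Adj j i
    irrefl : ∀ {i} → ¬ Adj i i

-- The complete rooted ternary tree of depth d.
-- A vertex is its address: the list of child indices (Fin 3) on the path
-- from the root; the vertices are the addresses of length ≤ d.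

Addr : Set
Addr = List (Fin 3)

IsVertex : ℕ → Addr → Set
IsVertex d w = length w ≤ d

addrs : ℕ → List Addr
addrs zero    = [] ∷ []
addrs (suc d) = [] ∷ concatMap (λ c → map (c ∷_) (addrs d)) (allFin 3)

-- a is a prefix of w, i.e. w lies in the subtree rooted at a
prefixᵇ : Addr → Addr → Bool
prefixᵇ []       _        = true
prefixᵇ (x ∷ xs) []       = false
prefixᵇ (x ∷ xs) (y ∷ ys) = ⌊ x ≟ y ⌋ ∧ prefixᵇ xs ys

InSub : ℕ → Addr → Addr → Set
InSub d a w = IsVertex d w × prefixᵇ a w ≡ true

-- Subsets of V(T(H)): a vertex w^i of T(H) is a pair (w , i), w a tree
-- vertex, i a vertex of H.  Subsets are given by their (decidable)
-- characteristic function.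

VSet : ℕ → Set
VSet n = Addr → Fin n → Bool

IsSubsetTH : ℕ → (n : ℕ) → VSet n → Set
IsSubsetTH d n V = ∀ w i → V w i ≡ true → IsVertex d w

occᵇ : ∀ {n} → VSet n → Addr → Bool
occᵇ {n} V' w = any (λ i → V' w i) (allFin n)

restrict : ∀ {n} → VSet n → Addr → VSet n
restrict V' a w i = V' w i ∧ prefixᵇ a w

ocCount : ∀ {n} → ℕ → Addr → VSet n → ℕ
ocCount d a V' = length (filterᵇ (λ w → prefixᵇ a w ∧ occᵇ V' w) (addrs d))

-- T_i is the subtree rooted at address a; the immediate subtrees of T_a
-- are the subtrees rooted at a ∷ʳ c (c : Fin 3), which exist iff the
-- root of T_a is not a leaf, i.e. length a < d.

LargestStep : ∀ {n} → ℕ → Addr → VSet n → Fin 3 → Set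
LargestStep d a Va c =
  length a < d ×
  (∀ c' → ocCount d (a ∷ʳ c') Va ≤ ocCount d (a ∷ʳ c) Va)

-- Seq d V a Va : there is a sequence of largest subtrees T_1 = T, … ,
-- T_i = T_a of T w.r.t. V, with corresponding sets V_1 = V, … , V_i = Va.
data Seq {n} (d : ℕ) (V : VSet n) : Addr → VSet n → Set where
  start : Seq d V [] V
  step  : ∀ {a Va c} → Seq d V a Va → LargestStep d a Va c →
          Seq d V (a ∷ʳ c) (restrict Va (a ∷ʳ c))

InStar : ℕ → Addr → Addr → Set
InStar d a w = IsVertex d w × prefixᵇ a w ≡ false

restrictStar : ∀ {n} → VSet n → Addr → VSet n
restrictStar V' a w i = V' w i ∧ not (prefixᵇ a w)

OC : ∀ {n} → (Addr → Set) → VSet n → Addr → Set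
OC T' V' w = T' w × occᵇ V' w ≡ true

_⊊_ : (Addr → Set) → (Addr → Set) → Set
A ⊊ B = (∀ w → A w → B w) × ∃ (λ w → B w × ¬ A w)

module Submission where

-- Let T_q = T_b with b = a ∷ʳ c, a largest immediate subtree of
-- T_{q-1} = T_a.  Take a vertex w₀ of T whose copy of H misses V.  If w₀ lies
-- outside T_b, it is a vertex of T* missing V* = V ∩ V(T*(H)).  Otherwise T_b
-- is not fully occupied; all immediate subtrees of T_a are copies of one
-- complete ternary tree, so a sibling T_{b'} of T_b has no more occupied
-- vertices than T_b (T_b is largest) out of the same total, hence it has an
-- unoccupied vertex too, and T_{b'} is disjoint from T_b, i.e. part of T*.

open import Defs
open import Data.Nat using (ℕ; _≤_; _<_; _+_)
open import Data.Fin using (Fin)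
open import Data.List using ([]; _∷ʳ_)

open import Data.Nat using (zero; suc; _∸_; z≤n; s≤s)
open import Data.Nat.Properties
  using (<-irrefl; ≤-<-trans; +-identityʳ; +-comm; +-cancelˡ-≤; +-monoʳ-≤; m+[n∸m]≡n)
open import Data.Fin using (_≟_)
open Fin
open import Data.Bool using (Bool; true; false; T; _∧_; not)
open import Data.Bool.Properties using (∧-identityʳ; ¬-not; not-¬)
open import Data.List using (List; _∷_; _++_; length; map; concatMap; allFin; filterᵇ)
open import Data.Nat.ListAction using (sum)
open import Data.Bool.ListAction using (or)
open import Data.List.Properties using (length-++; ++-assoc; map-cong; filter-++; filter-≐; filter-reject; filter-all; filter-notAll)
open import Data.List.Membership.Propositional using (_∈_; find)
open import Data.List.Membership.Propositional.Properties using (∈-map⁺; ∈-map⁻; ∈-concatMap⁺; ∈-concatMap⁻; ∈-allFin)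
open import Data.List.Relation.Unary.Any as Any using (here; there)
open import Data.List.Relation.Unary.All.Properties using (¬All⇒Any¬)
open import Data.Product using (∃; _×_; _,_; proj₁)
open import Function using (_∘_)
open import Relation.Nullary using (¬_; yes; no; contradiction)
open import Relation.Nullary.Decidable using (T?)
open import Relation.Binary.PropositionalEquality
open ≡-Reasoning

count : {A : Set} → (A → Bool) → List A → ℕ
count f xs = length (filterᵇ f xs)

module _ {A : Set} where

  count-cong : {f g : A → Bool} → (∀ x → f x ≡ g x) → ∀ xs → count f xs ≡ count g xs
  count-cong {f} {g} f≗g xs =
    cong length (filter-≐ (T? ∘ f) (T? ∘ g) ((λ {x} → subst T (f≗g x)) , (λ {x} → subst T (sym (f≗g x)))) xs)

  count-++ : ∀ (f : A → Bool) xs ys → count f (xs ++ ys) ≡ count f xs + count f ys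
  count-++ f xs ys = trans (cong length (filter-++ (T? ∘ f) xs ys)) (length-++ (filterᵇ f xs))

  count-false : ∀ (xs : List A) → count (λ _ → false) xs ≡ 0
  count-false []       = refl
  count-false (_ ∷ xs) = count-false xs

  count-< : ∀ {f : A → Bool} {x xs} → x ∈ xs → f x ≡ false → count f xs < length xs
  count-< {f} {xs = xs} x∈xs fx = filter-notAll (T? ∘ f) xs (Any.map (λ { refl → subst T fx }) x∈xs)

  count<length⇒failure : ∀ (f : A → Bool) xs → count f xs < length xs → ∃ λ x → x ∈ xs × f x ≡ false
  count<length⇒failure f xs lt =
    let (x , x∈xs , ¬fx) = find (¬All⇒Any¬ (T? ∘ f) xs λ all → <-irrefl (cong length (filter-all (T? ∘ f) all)) lt)
    in x , x∈xs , ¬-not (λ fx → ¬fx (subst T (sym fx) _))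

  failure-transfer : ∀ (f g : A → Bool) {x xs} → count f xs ≤ count g xs →
                     x ∈ xs → g x ≡ false → ∃ λ y → y ∈ xs × f y ≡ false
  failure-transfer f g {xs = xs} le x∈xs gx = count<length⇒failure f xs (≤-<-trans le (count-< x∈xs gx))

module _ {A B : Set} where

  count-map : ∀ (f : B → Bool) (h : A → B) xs → count f (map h xs) ≡ count (f ∘ h) xs
  count-map f h []       = refl
  count-map f h (x ∷ xs) with f (h x)
  ... | true  = cong suc (count-map f h xs)
  ... | false = count-map f h xs

  count-concatMap : ∀ (f : B → Bool) (g : A → List B) cs →
                    count f (concatMap g cs) ≡ sum (map (λ c → count f (g c)) cs)
  count-concatMap f g []       = refl
  count-concatMap f g (c ∷ cs) =
    trans (count-++ f (g c) (concatMap g cs)) (cong (count f (g c) +_) (count-concatMap f g cs))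

addrs-sound : ∀ {d w} → w ∈ addrs d → IsVertex d w
addrs-sound {zero}  (here refl) = z≤n
addrs-sound {suc d} (here refl) = z≤n
addrs-sound {suc d} (there w∈) with find (∈-concatMap⁻ (λ c → map (c ∷_) (addrs d)) {xs = allFin 3} w∈)
... | c , _ , w∈map with ∈-map⁻ (c ∷_) w∈map
...   | v , v∈ , refl = s≤s (addrs-sound v∈)

addrs-complete : ∀ {d w} → IsVertex d w → w ∈ addrs d
addrs-complete {zero}  {[]}    _       = here refl
addrs-complete {suc d} {[]}    _       = here refl
addrs-complete {suc d} {c ∷ w} (s≤s l) =
  there (∈-concatMap⁺ (λ c → map (c ∷_) (addrs d)) (Any.map (λ { refl → ∈-map⁺ (c ∷_) (addrs-complete l) }) (∈-allFin c)))

suffix-bound : ∀ {e d} x s → length x + e ≡ d → IsVertex d (x ++ s) → length s ≤ e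
suffix-bound x s refl l = +-cancelˡ-≤ (length x) _ _ (subst (_≤ _) (length-++ x) l)

suffix-vertex : ∀ {e d} x s → length x + e ≡ d → length s ≤ e → IsVertex d (x ++ s)
suffix-vertex x s refl l = subst (_≤ _) (sym (length-++ x)) (+-monoʳ-≤ (length x) l)

child-depth : ∀ {d} (a : Addr) x → length a < d → length (a ∷ʳ x) + (d ∸ suc (length a)) ≡ d
child-depth a x la = trans (cong (_+ _) (trans (length-++ a) (+-comm (length a) 1))) (m+[n∸m]≡n la)

prefix-++ : ∀ x s → prefixᵇ x (x ++ s) ≡ true
prefix-++ []      s = refl
prefix-++ (y ∷ x) s with y ≟ y
... | yes _   = prefix-++ x s
... | no y≢y = contradiction refl y≢y

prefix-split : ∀ x w → prefixᵇ x w ≡ true → ∃ λ s → w ≡ x ++ s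
prefix-split []      w       _ = w , refl
prefix-split (y ∷ x) (z ∷ w) p with y ≟ z
... | yes refl = let (s , w≡) = prefix-split x w p in s , cong (y ∷_) w≡

prefix-++ˡ : ∀ x y w → prefixᵇ (x ++ y) w ≡ true → prefixᵇ x w ≡ true
prefix-++ˡ x y w p with prefix-split (x ++ y) w p
... | s , refl = subst (λ v → prefixᵇ x v ≡ true) (sym (++-assoc x y s)) (prefix-++ x (y ++ s))

prefix-++-cancel : ∀ a t u → prefixᵇ (a ++ t) (a ++ u) ≡ prefixᵇ t u
prefix-++-cancel []      t u = refl
prefix-++-cancel (y ∷ a) t u with y ≟ y
... | yes _   = prefix-++-cancel a t u
... | no y≢y = contradiction refl y≢y

sibling : Fin 3 → Fin 3
sibling zero    = suc zero
sibling (suc _) = zero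

siblings-disjoint : ∀ a c w → prefixᵇ (a ∷ʳ sibling c) w ≡ true → prefixᵇ (a ∷ʳ c) w ≡ false
siblings-disjoint a c w p with prefix-split (a ∷ʳ sibling c) w p
... | s , refl = begin
  prefixᵇ (a ++ c ∷ []) ((a ++ sibling c ∷ []) ++ s) ≡⟨ cong (prefixᵇ (a ∷ʳ c)) (++-assoc a _ s) ⟩
  prefixᵇ (a ++ c ∷ []) (a ++ sibling c ∷ s)         ≡⟨ prefix-++-cancel a (c ∷ []) (sibling c ∷ s) ⟩
  prefixᵇ (c ∷ []) (sibling c ∷ s)                   ≡⟨ differ c ⟩
  false                                              ∎
  where
  differ : ∀ c → prefixᵇ (c ∷ []) (sibling c ∷ s) ≡ false
  differ zero    = refl
  differ (suc _) = refl

children-count : ∀ (f : Addr → Bool) d → f [] ≡ false →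
                 count f (addrs (suc d)) ≡ sum (map (λ c → count (λ w → f (c ∷ w)) (addrs d)) (allFin 3))
children-count f d f[] = begin
  count f ([] ∷ children)
    ≡⟨ cong length (filter-reject (T? ∘ f) (subst T f[])) ⟩
  count f children
    ≡⟨ count-concatMap f (λ c → map (c ∷_) (addrs d)) (allFin 3) ⟩
  sum (map (λ c → count f (map (c ∷_) (addrs d))) (allFin 3))
    ≡⟨ cong sum (map-cong (λ c → count-map f (c ∷_) (addrs d)) (allFin 3)) ⟩
  sum (map (λ c → count (λ w → f (c ∷ w)) (addrs d)) (allFin 3)) ∎
  where children = concatMap (λ c → map (c ∷_) (addrs d)) (allFin 3)

sum-single : ∀ y (g : Fin 3 → ℕ) → (∀ c → ¬ c ≡ y → g c ≡ 0) → sum (map g (allFin 3)) ≡ g y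
sum-single zero g others
  rewrite others (suc zero) (λ ()) | others (suc (suc zero)) (λ ()) = +-identityʳ (g zero)
sum-single (suc zero) g others
  rewrite others zero (λ ()) | others (suc (suc zero)) (λ ()) = +-identityʳ (g (suc zero))
sum-single (suc (suc zero)) g others
  rewrite others zero (λ ()) | others (suc zero) (λ ()) = +-identityʳ (g (suc (suc zero)))

subtree-count-step : ∀ y x d (P : Addr → Bool) →
  count (λ w → prefixᵇ (y ∷ x) w ∧ P w) (addrs (suc d)) ≡ count (λ w → prefixᵇ x w ∧ P (y ∷ w)) (addrs d)
subtree-count-step y x d P = begin
  count f (addrs (suc d))                                     ≡⟨ children-count f d refl ⟩
  sum (map (λ c → count (λ w → f (c ∷ w)) (addrs d)) (allFin 3)) ≡⟨ sum-single y _ other-child ⟩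
  count (λ w → f (y ∷ w)) (addrs d)                           ≡⟨ count-cong own-child (addrs d) ⟩
  count (λ w → prefixᵇ x w ∧ P (y ∷ w)) (addrs d)              ∎
  where
  f : Addr → Bool
  f w = prefixᵇ (y ∷ x) w ∧ P w
  other-child : ∀ c → ¬ c ≡ y → count (λ w → f (c ∷ w)) (addrs d) ≡ 0
  other-child c c≢y with y ≟ c
  ... | yes refl = contradiction refl c≢y
  ... | no _     = count-false (addrs d)
  own-child : ∀ w → f (y ∷ w) ≡ (prefixᵇ x w ∧ P (y ∷ w))
  own-child w with y ≟ y
  ... | yes _   = refl
  ... | no y≢y = contradiction refl y≢y

subtree-count : ∀ x e (P : Addr → Bool) →
  count (λ w → prefixᵇ x w ∧ P w) (addrs (length x + e)) ≡ count (λ s → P (x ++ s)) (addrs e)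
subtree-count []      e P = refl
subtree-count (y ∷ x) e P = trans (subtree-count-step y x (length x + e) P) (subtree-count x e (P ∘ (y ∷_)))

seq-agrees : ∀ {n d} {V : VSet n} {a Va} → Seq d V a Va →
             ∀ w i → prefixᵇ a w ≡ true → Va w i ≡ V w i
seq-agrees start w i _ = refl
seq-agrees {V = V} (step {a} {Va} {c} sq _) w i inT = begin
  Va w i ∧ prefixᵇ (a ∷ʳ c) w ≡⟨ cong (Va w i ∧_) inT ⟩
  Va w i ∧ true               ≡⟨ ∧-identityʳ (Va w i) ⟩
  Va w i                      ≡⟨ seq-agrees sq w i (prefix-++ˡ a (c ∷ []) w inT) ⟩
  V w i                       ∎

occ-cong : ∀ {n} (V V′ : VSet n) w → (∀ i → V w i ≡ V′ w i) → occᵇ V w ≡ occᵇ V′ w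
occ-cong {n} V V′ w agree = cong or (map-cong agree (allFin n))

subtree-occupancy : ∀ {n d} {V : VSet n} {a Va} (t : Addr) e → Seq d V a Va →
  length (a ++ t) + e ≡ d →
  ocCount d (a ++ t) Va ≡ count (λ s → occᵇ V ((a ++ t) ++ s)) (addrs e)
subtree-occupancy {V = V} {a} {Va} t e sq refl =
  trans (subtree-count (a ++ t) e (occᵇ Va))
        (count-cong (λ s → occ-cong Va V ((a ++ t) ++ s)
                      λ i → seq-agrees sq _ i (prefix-++ˡ a t _ (prefix-++ (a ++ t) s))) (addrs e))

sibling-vacancy : ∀ {n d} {V : VSet n} {a Va c w₀} → Seq d V a Va → LargestStep d a Va c →
  IsVertex d w₀ → prefixᵇ (a ∷ʳ c) w₀ ≡ true → occᵇ V w₀ ≡ false →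
  ∀ x → ∃ λ w → IsVertex d w × prefixᵇ (a ∷ʳ x) w ≡ true × occᵇ V w ≡ false
sibling-vacancy {d = d} {V} {a} {c = c} {w₀} sq (la , largest) vw₀ inT vac₀ x
  with prefix-split (a ∷ʳ c) w₀ inT
... | s₀ , refl =
  let (s , s∈ , vac) = failure-transfer (occupied x) (occupied c) fewer s₀∈ vac₀
  in (a ∷ʳ x) ++ s , suffix-vertex (a ∷ʳ x) s (depth x) (addrs-sound s∈) , prefix-++ (a ∷ʳ x) s , vac
  where
  e = d ∸ suc (length a)
  depth : ∀ x → length (a ∷ʳ x) + e ≡ d
  depth x = child-depth a x la
  occupied : Fin 3 → Addr → Bool
  occupied x s = occᵇ V ((a ∷ʳ x) ++ s)
  fewer : count (occupied x) (addrs e) ≤ count (occupied c) (addrs e)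
  fewer = subst₂ _≤_ (subtree-occupancy (x ∷ []) e sq (depth x))
                     (subtree-occupancy (c ∷ []) e sq (depth c)) (largest x)
  s₀∈ : s₀ ∈ addrs e
  s₀∈ = addrs-complete (suffix-bound (a ∷ʳ c) s₀ (depth c) vw₀)

star-occupancy : ∀ {n} (V : VSet n) b w → prefixᵇ b w ≡ false → occᵇ (restrictStar V b) w ≡ occᵇ V w
star-occupancy V b w out = occ-cong (restrictStar V b) V w λ i → trans (cong (λ z → V w i ∧ not z) out) (∧-identityʳ (V w i))

star-vacancy : ∀ {n d} (V : VSet n) b w → IsVertex d w → prefixᵇ b w ≡ false → occᵇ V w ≡ false →
  ∃ λ w → InStar d b w × ¬ OC (InStar d b) (restrictStar V b) w
star-vacancy V b w vw out vac =
  w , (vw , out) , λ (_ , occ) → not-¬ vac (trans (sym (star-occupancy V b w out)) occ)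

lemma6 : (p : ℕ) → 1 ≤ p → (H : Graph) → (d : ℕ) →
    (V : VSet (Graph.n H)) → IsSubsetTH d (Graph.n H) V →
    (a : Addr) (Va : VSet (Graph.n H)) (c : Fin 3) →
    Seq d V a Va → LargestStep d a Va c →
    ocCount d (a ∷ʳ c) (restrict Va (a ∷ʳ c)) + p ≤ ocCount d [] V →
    ocCount d [] V < ocCount d a Va + p →
    OC (IsVertex d) V ⊊ IsVertex d →
    OC (InStar d (a ∷ʳ c)) (restrictStar V (a ∷ʳ c)) ⊊ InStar d (a ∷ʳ c)
lemma6 p _ H d V _ a Va c sq largest _ _ (_ , w₀ , vw₀ , unoccupied) =
  (λ _ → proj₁) , vacancy
  where
  vac₀ : occᵇ V w₀ ≡ false
  vac₀ = ¬-not (λ occ → unoccupied (vw₀ , occ))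
  vacancy : ∃ λ w → InStar d (a ∷ʳ c) w × ¬ OC (InStar d (a ∷ʳ c)) (restrictStar V (a ∷ʳ c)) w
  vacancy with prefixᵇ (a ∷ʳ c) w₀ in inT
  ... | false = star-vacancy V (a ∷ʳ c) w₀ vw₀ inT vac₀
  ... | true with sibling-vacancy sq largest vw₀ inT vac₀ (sibling c)
  ...   | w , vw , inSibling , vac = star-vacancy V (a ∷ʳ c) w vw (siblings-disjoint a c w inSibling) vac
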